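{- Let $k\ge0$, let $T$ be a semi-classical arithmetic with $T\vdash\mathrm{LEM}(\Sigma_{k-1})$, and let $X$ be a set of sentences of the language of $\mathsf{HA}$ all belonging to $\mathcal{Q}_k$. Then $\mathsf{PA}+X$ is conservative over $T+X$ for all sentences in $\Sigma_{k+1}$ if and only if $T+X$ is closed under $\mathrm{DNE\text{ - }R}$ for sentences in $\Sigma_{k+1}$ (i.e. for every $\Sigma_{k+1}$ sentence $\varphi$, $T+X\vdash\neg\neg\varphi$ implies $T+X\vdash\varphi$).
   Context: $\mathsf{HA}$ is intuitionistic first-order arithmetic with function symbols for all primitive recursive functions and logical constants $\forall,\exists,\to,\land,\lor,\perp$ ($\neg\varphi:\equiv\varphi\to\perp$); $\mathsf{PA}$ is $\mathsf{HA}$ plus excluded middle for all formulas. A semi-classical arithmetic is a theory $T$ in the language of $\mathsf{HA}$ with $\mathsf{HA}\subseteq T\subseteq\mathsf{PA}$; $T+X$ adds the sentences of $X$ as axioms. "$T'$ is conservative over $T$ for sentences in $\Gamma$" means every sentence of $\Gamma$ provable in $T'$ is provable in $T$. $\Sigma_0=\Pi_0$ = quantifier-free formulas; $\Sigma_{k+1}$ = formulas $\exists x_1\cdots\exists x_n\varphi$, $\varphi\in\Pi_k$; $\Pi_{k+1}$ = formulas $\forall x_1\cdots\forall x_n\varphi$, $\varphi\in\Sigma_k$; $\Sigma_m=\Pi_m=\emptyset$ for $m<0$. $\mathrm{LEM}(\Sigma_{k-1})$ is the scheme $\varphi\lor\neg\varphi$ for $\varphi\in\Sigma_{k-1}$ (vacuous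 if $k=0$). Degree: an alternation path is a finite sequence of symbols $+,-$ in which they alternate; $i(s)$ is the first symbol of $s$ if nonempty and $\times$ if empty, $s^\perp$ swaps $+$ and $-$, $l(s)$ is the length. $\mathrm{Alt}(\varphi)=\{\langle\rangle\}$ for quantifier-free $\varphi$; otherwise $\mathrm{Alt}(\varphi_1\land\varphi_2)=\mathrm{Alt}(\varphi_1\lor\varphi_2)=\mathrm{Alt}(\varphi_1)\cup\mathrm{Alt}(\varphi_2)$, $\mathrm{Alt}(\varphi_1\to\varphi_2)=\{s^\perp:s\in\mathrm{Alt}(\varphi_1)\}\cup\mathrm{Alt}(\varphi_2)$, $\mathrm{Alt}(\forall x\varphi_1)=\{s\in\mathrm{Alt}(\varphi_1):i(s)=-\}\cup\{ -s:s\in\mathrm{Alt}(\varphi_1),i(s)\ne-\}$, $\mathrm{Alt}(\exists x\varphi_1)=\{s\in\mathrm{Alt}(\varphi_1):i(s)=+\}\cup\{+s:s\in\mathrm{Alt}(\varphi_1),i(s)\ne+\}$. $\deg(\varphi)=\max\{l(s):s\in\mathrm{Alt}(\varphi)\}$; $\mathrm{F}_m^+$ = formulas of degree $\le m$. $\mathcal{R}_0=\mathcal{J}_0=\Sigma_0$; for $m\ge0$, $\mathcal{R}_{m+1},\mathcal{J}_{m+1}$ are simultaneously generated by: every formula of $\mathrm{F}_m^+$ is in both; for $R,R'\in\mathcal{R}_{m+1}$, $J,J'\in\mathcal{J}_{m+1}$: $R\land R',R\lor R',\forall xR,J\to R\in\mathcal{R}_{m+1}$ and $J\land J',J\lor J',\exists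 xJ,R\to J\in\mathcal{J}_{m+1}$. $\mathcal{Q}_0=\Sigma_0$; $\mathcal{Q}_{m+1}$ is generated by prime formulas and closure under $\land,\lor,\forall x,\exists x$, and $J\to Q$ for $J\in\mathcal{J}_{m+1}$, $Q\in\mathcal{Q}_{m+1}$. -}

module Defs where

open import Data.Nat using (ℕ; zero; suc; _<_; _≤_; _⊔_)
open import Data.Fin using (Fin)
open import Data.Vec using (Vec; []; _∷_; lookup)
open import Data.List using (List; []; _∷_; _++_; map; foldr; length)
open import Data.List.Membership.Propositional using (_∈_)
open import Data.Product using (Σ; _×_; _,_)
open import Data.Sum using (_⊎_)
open import Data.Unit using (⊤)
open import Relation.Binary.PropositionalEquality using (_≡_)

-- Primitive recursive function symbols, indexed by arity.
--   compF f gs (x⃗)        = f (g₁ x⃗, …, g_m x⃗)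
--   recF g h (0 , x⃗)      = g x⃗
--   recF g h (S y , x⃗)    = h (y , recF g h (y , x⃗) , x⃗)

data PR : ℕ → Set where
  zeroF : PR 0
  succF : PR 1
  projF : ∀ {n} → Fin n → PR n
  compF : ∀ {m n} → PR m → Vec (PR n) m → PR n
  recF  : ∀ {n} → PR n → PR (suc (suc n)) → PR (suc n)

data Term : Set where
  var : ℕ → Term
  app : ∀ {n} → PR n → Vec Term n → Term

infixr 6 _∧̇_
infixr 5 _∨̇_
infixr 4 _⇒_
infix  7 _≐_

data Formula : Set where
  fal  : Formula
  _≐_  : Term → Term → Formula
  _∧̇_  : Formula → Formula → Formula
  _∨̇_  : Formula → Formula → Formula
  _⇒_  : Formula → Formula → Formula
  ∀̇    : Formula → Formula
  ∃̇    : Formula → Formula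

¬̇ : Formula → Formula
¬̇ φ = φ ⇒ fal

0̇ : Term
0̇ = app zeroF []

Ṡ : Term → Term
Ṡ t = app succF (t ∷ [])

mutual
  renT : (ℕ → ℕ) → Term → Term
  renT ρ (var x)    = var (ρ x)
  renT ρ (app f ts) = app f (renV ρ ts)

  renV : ∀ {n} → (ℕ → ℕ) → Vec Term n → Vec Term n
  renV ρ []       = []
  renV ρ (t ∷ ts) = renT ρ t ∷ renV ρ ts

mutual
  subT : (ℕ → Term) → Term → Term
  subT σ (var x)    = σ x
  subT σ (app f ts) = app f (subV σ ts)

  subV : ∀ {n} → (ℕ → Term) → Vec Term n → Vec Term n
  subV σ []       = []
  subV σ (t ∷ ts) = subT σ t ∷ subV σ ts

liftR : (ℕ → ℕ) → ℕ → ℕ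
liftR ρ zero    = zero
liftR ρ (suc x) = suc (ρ x)

liftS : (ℕ → Term) → ℕ → Term
liftS σ zero    = var zero
liftS σ (suc x) = renT suc (σ x)

ren : (ℕ → ℕ) → Formula → Formula
ren ρ fal       = fal
ren ρ (t ≐ s)   = renT ρ t ≐ renT ρ s
ren ρ (φ ∧̇ ψ)   = ren ρ φ ∧̇ ren ρ ψ
ren ρ (φ ∨̇ ψ)   = ren ρ φ ∨̇ ren ρ ψ
ren ρ (φ ⇒ ψ)   = ren ρ φ ⇒ ren ρ ψ
ren ρ (∀̇ φ)     = ∀̇ (ren (liftR ρ) φ)
ren ρ (∃̇ φ)     = ∃̇ (ren (liftR ρ) φ)

sub : (ℕ → Term) → Formula → Formula
sub σ fal       = fal
sub σ (t ≐ s)   = subT σ t ≐ subT σ s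
sub σ (φ ∧̇ ψ)   = sub σ φ ∧̇ sub σ ψ
sub σ (φ ∨̇ ψ)   = sub σ φ ∨̇ sub σ ψ
sub σ (φ ⇒ ψ)   = sub σ φ ⇒ sub σ ψ
sub σ (∀̇ φ)     = ∀̇ (sub (liftS σ) φ)
sub σ (∃̇ φ)     = ∃̇ (sub (liftS σ) φ)

shift : Formula → Formula
shift = ren suc

single : Term → ℕ → Term
single t zero    = t
single t (suc x) = var x

_[_] : Formula → Term → Formula
φ [ t ] = sub (single t) φ

succSub : ℕ → Term
succSub zero    = Ṡ (var zero)
succSub (suc x) = var (suc x)

mutual
  TermBelow : ℕ → Term → Set
  TermBelow n (var x)    = x < n
  TermBelow n (app f ts) = VecBelow n ts

  VecBelow : ∀ {m} → ℕ → Vec Term m → Set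
  VecBelow n []       = ⊤
  VecBelow n (t ∷ ts) = TermBelow n t × VecBelow n ts

FreeBelow : ℕ → Formula → Set
FreeBelow n fal     = ⊤
FreeBelow n (t ≐ s) = TermBelow n t × TermBelow n s
FreeBelow n (φ ∧̇ ψ) = FreeBelow n φ × FreeBelow n ψ
FreeBelow n (φ ∨̇ ψ) = FreeBelow n φ × FreeBelow n ψ
FreeBelow n (φ ⇒ ψ) = FreeBelow n φ × FreeBelow n ψ
FreeBelow n (∀̇ φ)   = FreeBelow (suc n) φ
FreeBelow n (∃̇ φ)   = FreeBelow (suc n) φ

Sentence : Formula → Set
Sentence = FreeBelow 0

-- Derivability: intuitionistic natural deduction with equality and the
-- non-logical axioms of HA built in, relative to an extra axiom set A.
-- (Axioms with free variables are read as their universal closures.)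

Theory : Set₁
Theory = Formula → Set

infix 2 _∣_⊢_

data _∣_⊢_ (A : Theory) : List Formula → Formula → Set where
  ax    : ∀ {Γ φ} → A φ → A ∣ Γ ⊢ φ
  hyp   : ∀ {Γ φ} → φ ∈ Γ → A ∣ Γ ⊢ φ
  ⊥E    : ∀ {Γ φ} → A ∣ Γ ⊢ fal → A ∣ Γ ⊢ φ
  ∧I    : ∀ {Γ φ ψ} → A ∣ Γ ⊢ φ → A ∣ Γ ⊢ ψ → A ∣ Γ ⊢ φ ∧̇ ψ
  ∧E₁   : ∀ {Γ φ ψ} → A ∣ Γ ⊢ φ ∧̇ ψ → A ∣ Γ ⊢ φ
  ∧E₂   : ∀ {Γ φ ψ} → A ∣ Γ ⊢ φ ∧̇ ψ → A ∣ Γ ⊢ ψ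
  ∨I₁   : ∀ {Γ φ ψ} → A ∣ Γ ⊢ φ → A ∣ Γ ⊢ φ ∨̇ ψ
  ∨I₂   : ∀ {Γ φ ψ} → A ∣ Γ ⊢ ψ → A ∣ Γ ⊢ φ ∨̇ ψ
  ∨E    : ∀ {Γ φ ψ χ} → A ∣ Γ ⊢ φ ∨̇ ψ → A ∣ φ ∷ Γ ⊢ χ → A ∣ ψ ∷ Γ ⊢ χ
          → A ∣ Γ ⊢ χ
  ⇒I    : ∀ {Γ φ ψ} → A ∣ φ ∷ Γ ⊢ ψ → A ∣ Γ ⊢ φ ⇒ ψ
  ⇒E    : ∀ {Γ φ ψ} → A ∣ Γ ⊢ φ ⇒ ψ → A ∣ Γ ⊢ φ → A ∣ Γ ⊢ ψ
  ∀I    : ∀ {Γ φ} → A ∣ map shift Γ ⊢ φ → A ∣ Γ ⊢ ∀̇ φ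
  ∀E    : ∀ {Γ φ} (t : Term) → A ∣ Γ ⊢ ∀̇ φ → A ∣ Γ ⊢ φ [ t ]
  ∃I    : ∀ {Γ φ} (t : Term) → A ∣ Γ ⊢ φ [ t ] → A ∣ Γ ⊢ ∃̇ φ
  ∃E    : ∀ {Γ φ ψ} → A ∣ Γ ⊢ ∃̇ φ → A ∣ φ ∷ map shift Γ ⊢ shift ψ
          → A ∣ Γ ⊢ ψ
  ≐refl : ∀ {Γ} (t : Term) → A ∣ Γ ⊢ t ≐ t
  ≐subst : ∀ {Γ} (φ : Formula) {t s : Term} → A ∣ Γ ⊢ t ≐ s
          → A ∣ Γ ⊢ φ [ t ] → A ∣ Γ ⊢ φ [ s ]
  succ≢0 : ∀ {Γ} (t : Term) → A ∣ Γ ⊢ ¬̇ (Ṡ t ≐ 0̇)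
  succInj : ∀ {Γ} (t s : Term) → A ∣ Γ ⊢ Ṡ t ≐ Ṡ s ⇒ t ≐ s
  projAx : ∀ {Γ n} (i : Fin n) (ts : Vec Term n)
          → A ∣ Γ ⊢ app (projF i) ts ≐ lookup ts i
  compAx : ∀ {Γ m n} (f : PR m) (gs : Vec (PR n) m) (ts : Vec Term n)
          → A ∣ Γ ⊢ app (compF f gs) ts ≐ app f (Data.Vec.map (λ g → app g ts) gs)
  rec0Ax : ∀ {Γ n} (g : PR n) (h : PR (suc (suc n))) (ts : Vec Term n)
          → A ∣ Γ ⊢ app (recF g h) (0̇ ∷ ts) ≐ app g ts
  recSAx : ∀ {Γ n} (g : PR n) (h : PR (suc (suc n))) (t : Term) (ts : Vec Term n)
          → A ∣ Γ ⊢ app (recF g h) (Ṡ t ∷ ts)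
                    ≐ app h (t ∷ app (recF g h) (t ∷ ts) ∷ ts)
  ind   : ∀ {Γ} (φ : Formula) → A ∣ Γ ⊢ φ [ 0̇ ] → A ∣ Γ ⊢ ∀̇ (φ ⇒ sub succSub φ)
          → A ∣ Γ ⊢ ∀̇ φ

Prov : Theory → Formula → Set
Prov A φ = A ∣ [] ⊢ φ

_⊕_ : Theory → Theory → Theory
(T ⊕ X) φ = T φ ⊎ X φ

HAax : Theory
HAax _ = Data.Empty.⊥
  where import Data.Empty

-- excluded middle for all formulas: PA = HA + LEMall
LEMall : Theory
LEMall φ = Σ Formula (λ ψ → φ ≡ (ψ ∨̇ ¬̇ ψ))

-- A semi-classical arithmetic, given by an axiom set T (on top of HA):
-- HA ⊆ T holds by construction, and T ⊆ PA is required.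
SemiClassical : Theory → Set
SemiClassical T = ∀ φ → T φ → Prov LEMall φ

data QF : Formula → Set where
  qfFal : QF fal
  qfEq  : ∀ t s → QF (t ≐ s)
  qf∧   : ∀ {φ ψ} → QF φ → QF ψ → QF (φ ∧̇ ψ)
  qf∨   : ∀ {φ ψ} → QF φ → QF ψ → QF (φ ∨̇ ψ)
  qf⇒   : ∀ {φ ψ} → QF φ → QF ψ → QF (φ ⇒ ψ)

mutual
  data Sig : ℕ → Formula → Set where
    sig0 : ∀ {φ} → QF φ → Sig 0 φ
    sigB : ∀ {k φ} → Pi k φ → Sig (suc k) φ
    sig∃ : ∀ {k φ} → Sig (suc k) φ → Sig (suc k) (∃̇ φ)

  data Pi : ℕ → Formula → Set where
    pi0 : ∀ {φ} → QF φ → Pi 0 φ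
    piB : ∀ {k φ} → Sig k φ → Pi (suc k) φ
    pi∀ : ∀ {k φ} → Pi (suc k) φ → Pi (suc k) (∀̇ φ)

-- T ⊢ LEM(Σ_{k-1}); vacuous for k = 0
LEMbelow : ℕ → Theory → Set
LEMbelow zero    T = ⊤
LEMbelow (suc j) T = ∀ φ → Sig j φ → Prov T (φ ∨̇ ¬̇ φ)

data Sign : Set where
  plus minus : Sign

flipS : Sign → Sign
flipS plus  = minus
flipS minus = plus

Path : Set
Path = List Sign

perp : Path → Path
perp = map flipS

stepAll : Path → Path
stepAll (minus ∷ s) = minus ∷ s
stepAll s           = minus ∷ s

stepEx : Path → Path
stepEx (plus ∷ s) = plus ∷ s
stepEx s          = plus ∷ s

-- Alt(φ) as a list (a finite set); on quantifier-free formulas this yields {⟨⟩}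
Alt : Formula → List Path
Alt fal     = [] ∷ []
Alt (t ≐ s) = [] ∷ []
Alt (φ ∧̇ ψ) = Alt φ ++ Alt ψ
Alt (φ ∨̇ ψ) = Alt φ ++ Alt ψ
Alt (φ ⇒ ψ) = map perp (Alt φ) ++ Alt ψ
Alt (∀̇ φ)   = map stepAll (Alt φ)
Alt (∃̇ φ)   = map stepEx (Alt φ)

deg : Formula → ℕ
deg φ = foldr (λ s m → length s ⊔ m) 0 (Alt φ)

Fplus : ℕ → Formula → Set
Fplus m φ = deg φ ≤ m

mutual
  data R : ℕ → Formula → Set where
    r0  : ∀ {φ} → QF φ → R 0 φ
    rF  : ∀ {m φ} → Fplus m φ → R (suc m) φ
    r∧  : ∀ {m φ ψ} → R (suc m) φ → R (suc m) ψ → R (suc m) (φ ∧̇ ψ)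
    r∨  : ∀ {m φ ψ} → R (suc m) φ → R (suc m) ψ → R (suc m) (φ ∨̇ ψ)
    r∀  : ∀ {m φ} → R (suc m) φ → R (suc m) (∀̇ φ)
    r⇒  : ∀ {m φ ψ} → J (suc m) φ → R (suc m) ψ → R (suc m) (φ ⇒ ψ)

  data J : ℕ → Formula → Set where
    j0  : ∀ {φ} → QF φ → J 0 φ
    jF  : ∀ {m φ} → Fplus m φ → J (suc m) φ
    j∧  : ∀ {m φ ψ} → J (suc m) φ → J (suc m) ψ → J (suc m) (φ ∧̇ ψ)
    j∨  : ∀ {m φ ψ} → J (suc m) φ → J (suc m) ψ → J (suc m) (φ ∨̇ ψ)
    j∃  : ∀ {m φ} → J (suc m) φ → J (suc m) (∃̇ φ)
    j⇒  : ∀ {m φ ψ} → R (suc m) φ → J (suc m) ψ → J (suc m) (φ ⇒ ψ)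

data Q : ℕ → Formula → Set where
  q0   : ∀ {φ} → QF φ → Q 0 φ
  qEq  : ∀ {m} t s → Q (suc m) (t ≐ s)
  qFal : ∀ {m} → Q (suc m) fal
  q∧   : ∀ {m φ ψ} → Q (suc m) φ → Q (suc m) ψ → Q (suc m) (φ ∧̇ ψ)
  q∨   : ∀ {m φ ψ} → Q (suc m) φ → Q (suc m) ψ → Q (suc m) (φ ∨̇ ψ)
  q∀   : ∀ {m φ} → Q (suc m) φ → Q (suc m) (∀̇ φ)
  q∃   : ∀ {m φ} → Q (suc m) φ → Q (suc m) (∃̇ φ)
  q⇒   : ∀ {m φ ψ} → J (suc m) φ → Q (suc m) ψ → Q (suc m) (φ ⇒ ψ)

ConservativeΣ : ℕ → Theory → Theory → Set
ConservativeΣ k T X =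
  ∀ φ → Sentence φ → Sig (suc k) φ → Prov (LEMall ⊕ X) φ → Prov (T ⊕ X) φ

DNERClosedΣ : ℕ → Theory → Theory → Set
DNERClosedΣ k T X =
  ∀ φ → Sentence φ → Sig (suc k) φ → Prov (T ⊕ X) (¬̇ (¬̇ φ)) → Prov (T ⊕ X) φ

-- Conservativity gives DNE-R because PA ⊢ ¬¬φ → φ. Conversely, a PA + X proof of φ becomes,
-- under the Gödel–Gentzen translation, an HA proof of φᴺ from the translated axioms Xᴺ.
-- The translation agrees with double negation on enough formulas to finish: by prenex
-- normal forms, LEM(Σₖ₋₁) makes every formula of degree < k decidable, hence Nψ ↔ ¬¬ψ
-- for them; this spreads to ¬¬ψ → ψᴺ on 𝓡ₖ and 𝓠ₖ and to ψᴺ → ¬¬ψ on 𝓙ₖ and Σₖ₊₁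
-- (the ∀ step needs stability of the body). So T + X proves each χᴺ, χ ∈ X, and then ¬¬φ.

module Submission where

open import Defs
open import Data.Nat using (ℕ; zero; suc; _≤_; _<_; _⊔_; z≤n; s≤s; _≤′_; ≤′-refl; ≤′-step)
open import Data.Nat.Properties
  using (≤-refl; ≤-trans; n≤1+n; <⇒≤; m≤n⇒m≤1+n; m⊔n≤o⇒m≤o; m⊔n≤o⇒n≤o; ≤⇒≤′)
open import Data.Vec using (Vec; []; _∷_)
open import Data.List using ([]; _∷_; map; length; foldr)
open import Data.List.Properties using (length-map)
open import Data.List.Relation.Unary.Any using (here; there)
open import Data.List.Relation.Unary.All using (All; []; _∷_) renaming (map to All-map)
open import Data.List.Relation.Unary.All.Properties using (map⁺; map⁻; ++⁺; ++⁻ˡ; ++⁻ʳ)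
open import Data.List.Relation.Binary.Subset.Propositional using (_⊆_)
open import Data.List.Relation.Binary.Subset.Propositional.Properties
  using (∷⁺ʳ) renaming (map⁺ to ⊆-map⁺)
open import Data.List.Membership.Propositional.Properties using (∈-map⁺)
open import Data.Product using (Σ; _×_; _,_; proj₁; proj₂)
open import Data.Sum using (inj₁; inj₂)
open import Data.Unit using (⊤; tt)
open import Function.Bundles using (_⇔_; mk⇔)
open import Relation.Binary.PropositionalEquality
  using (_≡_; _≗_; refl; sym; trans; cong; cong₂; subst)

mutual
  subT-cong : ∀ {σ τ} → σ ≗ τ → ∀ t → subT σ t ≡ subT τ t
  subT-cong e (var x)    = e x
  subT-cong e (app f ts) = cong (app f) (subV-cong e ts)

  subV-cong : ∀ {σ τ n} → σ ≗ τ → (ts : Vec Term n) → subV σ ts ≡ subV τ ts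
  subV-cong e []       = refl
  subV-cong e (t ∷ ts) = cong₂ _∷_ (subT-cong e t) (subV-cong e ts)

liftS-cong : ∀ {σ τ} → σ ≗ τ → liftS σ ≗ liftS τ
liftS-cong e zero    = refl
liftS-cong e (suc x) = cong (renT suc) (e x)

sub-cong : ∀ {σ τ} → σ ≗ τ → ∀ φ → sub σ φ ≡ sub τ φ
sub-cong e fal     = refl
sub-cong e (t ≐ s) = cong₂ _≐_ (subT-cong e t) (subT-cong e s)
sub-cong e (φ ∧̇ ψ) = cong₂ _∧̇_ (sub-cong e φ) (sub-cong e ψ)
sub-cong e (φ ∨̇ ψ) = cong₂ _∨̇_ (sub-cong e φ) (sub-cong e ψ)
sub-cong e (φ ⇒ ψ) = cong₂ _⇒_ (sub-cong e φ) (sub-cong e ψ)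
sub-cong e (∀̇ φ)   = cong ∀̇ (sub-cong (liftS-cong e) φ)
sub-cong e (∃̇ φ)   = cong ∃̇ (sub-cong (liftS-cong e) φ)

mutual
  subT-renT : ∀ σ ρ t → subT σ (renT ρ t) ≡ subT (λ x → σ (ρ x)) t
  subT-renT σ ρ (var x)    = refl
  subT-renT σ ρ (app f ts) = cong (app f) (subV-renV σ ρ ts)

  subV-renV : ∀ {n} σ ρ (ts : Vec Term n) → subV σ (renV ρ ts) ≡ subV (λ x → σ (ρ x)) ts
  subV-renV σ ρ []       = refl
  subV-renV σ ρ (t ∷ ts) = cong₂ _∷_ (subT-renT σ ρ t) (subV-renV σ ρ ts)

liftS-liftR : ∀ σ ρ → (λ x → liftS σ (liftR ρ x)) ≗ liftS (λ x → σ (ρ x))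
liftS-liftR σ ρ zero    = refl
liftS-liftR σ ρ (suc x) = refl

sub-ren : ∀ σ ρ φ → sub σ (ren ρ φ) ≡ sub (λ x → σ (ρ x)) φ
sub-ren σ ρ fal     = refl
sub-ren σ ρ (t ≐ s) = cong₂ _≐_ (subT-renT σ ρ t) (subT-renT σ ρ s)
sub-ren σ ρ (φ ∧̇ ψ) = cong₂ _∧̇_ (sub-ren σ ρ φ) (sub-ren σ ρ ψ)
sub-ren σ ρ (φ ∨̇ ψ) = cong₂ _∨̇_ (sub-ren σ ρ φ) (sub-ren σ ρ ψ)
sub-ren σ ρ (φ ⇒ ψ) = cong₂ _⇒_ (sub-ren σ ρ φ) (sub-ren σ ρ ψ)
sub-ren σ ρ (∀̇ φ)   = cong ∀̇ (trans (sub-ren (liftS σ) (liftR ρ) φ) (sub-cong (liftS-liftR σ ρ) φ))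
sub-ren σ ρ (∃̇ φ)   = cong ∃̇ (trans (sub-ren (liftS σ) (liftR ρ) φ) (sub-cong (liftS-liftR σ ρ) φ))

mutual
  subT-id : ∀ {σ} → σ ≗ var → ∀ t → subT σ t ≡ t
  subT-id e (var x)    = e x
  subT-id e (app f ts) = cong (app f) (subV-id e ts)

  subV-id : ∀ {σ n} → σ ≗ var → (ts : Vec Term n) → subV σ ts ≡ ts
  subV-id e []       = refl
  subV-id e (t ∷ ts) = cong₂ _∷_ (subT-id e t) (subV-id e ts)

liftS-id : ∀ {σ} → σ ≗ var → liftS σ ≗ var
liftS-id e zero    = refl
liftS-id e (suc x) = cong (renT suc) (e x)

sub-id : ∀ {σ} → σ ≗ var → ∀ φ → sub σ φ ≡ φ
sub-id e fal     = refl
sub-id e (t ≐ s) = cong₂ _≐_ (subT-id e t) (subT-id e s)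
sub-id e (φ ∧̇ ψ) = cong₂ _∧̇_ (sub-id e φ) (sub-id e ψ)
sub-id e (φ ∨̇ ψ) = cong₂ _∨̇_ (sub-id e φ) (sub-id e ψ)
sub-id e (φ ⇒ ψ) = cong₂ _⇒_ (sub-id e φ) (sub-id e ψ)
sub-id e (∀̇ φ)   = cong ∀̇ (sub-id (liftS-id e) φ)
sub-id e (∃̇ φ)   = cong ∃̇ (sub-id (liftS-id e) φ)

-- ren (liftR suc) φ is the body of shift (∀̇ φ) and of shift (∃̇ φ).
[var0]-liftR-suc : ∀ φ → ren (liftR suc) φ [ var zero ] ≡ φ
[var0]-liftR-suc φ = trans (sub-ren (single (var zero)) (liftR suc) φ)
                           (sub-id (λ { zero → refl ; (suc x) → refl }) φ)

[]-shift : ∀ φ t → shift φ [ t ] ≡ φ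
[]-shift φ t = trans (sub-ren (single t) suc φ) (sub-id (λ x → refl) φ)

weaken : ∀ {A Γ Δ φ} → Γ ⊆ Δ → A ∣ Γ ⊢ φ → A ∣ Δ ⊢ φ
weaken Γ⊆Δ (ax a)          = ax a
weaken Γ⊆Δ (hyp i)         = hyp (Γ⊆Δ i)
weaken Γ⊆Δ (⊥E d)          = ⊥E (weaken Γ⊆Δ d)
weaken Γ⊆Δ (∧I d e)        = ∧I (weaken Γ⊆Δ d) (weaken Γ⊆Δ e)
weaken Γ⊆Δ (∧E₁ d)         = ∧E₁ (weaken Γ⊆Δ d)
weaken Γ⊆Δ (∧E₂ d)         = ∧E₂ (weaken Γ⊆Δ d)
weaken Γ⊆Δ (∨I₁ d)         = ∨I₁ (weaken Γ⊆Δ d)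
weaken Γ⊆Δ (∨I₂ d)         = ∨I₂ (weaken Γ⊆Δ d)
weaken Γ⊆Δ (∨E d e f)      = ∨E (weaken Γ⊆Δ d) (weaken (∷⁺ʳ _ Γ⊆Δ) e) (weaken (∷⁺ʳ _ Γ⊆Δ) f)
weaken Γ⊆Δ (⇒I d)          = ⇒I (weaken (∷⁺ʳ _ Γ⊆Δ) d)
weaken Γ⊆Δ (⇒E d e)        = ⇒E (weaken Γ⊆Δ d) (weaken Γ⊆Δ e)
weaken Γ⊆Δ (∀I d)          = ∀I (weaken (⊆-map⁺ shift Γ⊆Δ) d)
weaken Γ⊆Δ (∀E t d)        = ∀E t (weaken Γ⊆Δ d)
weaken Γ⊆Δ (∃I t d)        = ∃I t (weaken Γ⊆Δ d)
weaken Γ⊆Δ (∃E d e)        = ∃E (weaken Γ⊆Δ d) (weaken (∷⁺ʳ _ (⊆-map⁺ shift Γ⊆Δ)) e)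
weaken Γ⊆Δ (≐refl t)       = ≐refl t
weaken Γ⊆Δ (≐subst φ d e)  = ≐subst φ (weaken Γ⊆Δ d) (weaken Γ⊆Δ e)
weaken Γ⊆Δ (succ≢0 t)      = succ≢0 t
weaken Γ⊆Δ (succInj t s)   = succInj t s
weaken Γ⊆Δ (projAx i ts)   = projAx i ts
weaken Γ⊆Δ (compAx f gs ts) = compAx f gs ts
weaken Γ⊆Δ (rec0Ax g h ts) = rec0Ax g h ts
weaken Γ⊆Δ (recSAx g h t ts) = recSAx g h t ts
weaken Γ⊆Δ (ind φ d e)     = ind φ (weaken Γ⊆Δ d) (weaken Γ⊆Δ e)

weaken₁ : ∀ {A Γ φ ψ} → A ∣ Γ ⊢ φ → A ∣ ψ ∷ Γ ⊢ φ
weaken₁ = weaken there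

Prov⇒⊢ : ∀ {A Γ φ} → Prov A φ → A ∣ Γ ⊢ φ
Prov⇒⊢ = weaken λ ()

reaxiomatise : ∀ {A B Γ φ} → (∀ ψ → A ψ → Prov B ψ) → A ∣ Γ ⊢ φ → B ∣ Γ ⊢ φ
reaxiomatise A⊢B (ax a)           = Prov⇒⊢ (A⊢B _ a)
reaxiomatise A⊢B (hyp i)          = hyp i
reaxiomatise A⊢B (⊥E d)           = ⊥E (reaxiomatise A⊢B d)
reaxiomatise A⊢B (∧I d e)         = ∧I (reaxiomatise A⊢B d) (reaxiomatise A⊢B e)
reaxiomatise A⊢B (∧E₁ d)          = ∧E₁ (reaxiomatise A⊢B d)
reaxiomatise A⊢B (∧E₂ d)          = ∧E₂ (reaxiomatise A⊢B d)
reaxiomatise A⊢B (∨I₁ d)          = ∨I₁ (reaxiomatise A⊢B d)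
reaxiomatise A⊢B (∨I₂ d)          = ∨I₂ (reaxiomatise A⊢B d)
reaxiomatise A⊢B (∨E d e f)       = ∨E (reaxiomatise A⊢B d) (reaxiomatise A⊢B e) (reaxiomatise A⊢B f)
reaxiomatise A⊢B (⇒I d)           = ⇒I (reaxiomatise A⊢B d)
reaxiomatise A⊢B (⇒E d e)         = ⇒E (reaxiomatise A⊢B d) (reaxiomatise A⊢B e)
reaxiomatise A⊢B (∀I d)           = ∀I (reaxiomatise A⊢B d)
reaxiomatise A⊢B (∀E t d)         = ∀E t (reaxiomatise A⊢B d)
reaxiomatise A⊢B (∃I t d)         = ∃I t (reaxiomatise A⊢B d)
reaxiomatise A⊢B (∃E d e)         = ∃E (reaxiomatise A⊢B d) (reaxiomatise A⊢B e)
reaxiomatise A⊢B (≐refl t)        = ≐refl t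
reaxiomatise A⊢B (≐subst φ d e)   = ≐subst φ (reaxiomatise A⊢B d) (reaxiomatise A⊢B e)
reaxiomatise A⊢B (succ≢0 t)       = succ≢0 t
reaxiomatise A⊢B (succInj t s)    = succInj t s
reaxiomatise A⊢B (projAx i ts)    = projAx i ts
reaxiomatise A⊢B (compAx f gs ts) = compAx f gs ts
reaxiomatise A⊢B (rec0Ax g h ts)  = rec0Ax g h ts
reaxiomatise A⊢B (recSAx g h t ts) = recSAx g h t ts
reaxiomatise A⊢B (ind φ d e)      = ind φ (reaxiomatise A⊢B d) (reaxiomatise A⊢B e)

⊕-inj₁ : ∀ {A B Γ φ} → A ∣ Γ ⊢ φ → (A ⊕ B) ∣ Γ ⊢ φ
⊕-inj₁ = reaxiomatise λ _ a → ax (inj₁ a)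

module _ {A : Theory} where

  #0 : ∀ {Γ φ} → A ∣ φ ∷ Γ ⊢ φ
  #0 = hyp (here refl)

  #1 : ∀ {Γ φ ψ} → A ∣ ψ ∷ φ ∷ Γ ⊢ φ
  #1 = hyp (there (here refl))

  #2 : ∀ {Γ φ ψ χ} → A ∣ χ ∷ ψ ∷ φ ∷ Γ ⊢ φ
  #2 = hyp (there (there (here refl)))

  #3 : ∀ {Γ φ ψ χ ω} → A ∣ ω ∷ χ ∷ ψ ∷ φ ∷ Γ ⊢ φ
  #3 = hyp (there (there (there (here refl))))

  mp : ∀ {Γ φ ψ} → Prov A (φ ⇒ ψ) → A ∣ Γ ⊢ φ → A ∣ Γ ⊢ ψ
  mp φ⇒ψ d = ⇒E (Prov⇒⊢ φ⇒ψ) d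

  cast : ∀ {Γ φ ψ} → φ ≡ ψ → A ∣ Γ ⊢ φ → A ∣ Γ ⊢ ψ
  cast = subst (A ∣ _ ⊢_)

  ∀E-var0 : ∀ {Γ φ} → A ∣ Γ ⊢ ∀̇ (ren (liftR suc) φ) → A ∣ Γ ⊢ φ
  ∀E-var0 {φ = φ} d = cast ([var0]-liftR-suc φ) (∀E (var zero) d)

  ∃I-var0 : ∀ {Γ φ} → A ∣ Γ ⊢ φ → A ∣ Γ ⊢ ∃̇ (ren (liftR suc) φ)
  ∃I-var0 {φ = φ} d = ∃I (var zero) (cast (sym ([var0]-liftR-suc φ)) d)

  ¬¬-intro : ∀ {Γ φ} → A ∣ Γ ⊢ φ → A ∣ Γ ⊢ ¬̇ (¬̇ φ)
  ¬¬-intro d = ⇒I (⇒E #0 (weaken₁ d))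

  ¬¬¬⇒¬ : ∀ φ → Prov A (¬̇ (¬̇ (¬̇ φ)) ⇒ ¬̇ φ)
  ¬¬¬⇒¬ φ = ⇒I (⇒I (⇒E #1 (⇒I (⇒E #0 #1))))

-- The Gödel–Gentzen negative translation

N : Formula → Formula
N fal     = fal
N (t ≐ s) = ¬̇ (¬̇ (t ≐ s))
N (φ ∧̇ ψ) = N φ ∧̇ N ψ
N (φ ∨̇ ψ) = ¬̇ (¬̇ (N φ) ∧̇ ¬̇ (N ψ))
N (φ ⇒ ψ) = N φ ⇒ N ψ
N (∀̇ φ)   = ∀̇ (N φ)
N (∃̇ φ)   = ¬̇ (∀̇ (¬̇ (N φ)))

N-sub : ∀ σ φ → N (sub σ φ) ≡ sub σ (N φ)
N-sub σ fal     = refl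
N-sub σ (t ≐ s) = refl
N-sub σ (φ ∧̇ ψ) = cong₂ _∧̇_ (N-sub σ φ) (N-sub σ ψ)
N-sub σ (φ ∨̇ ψ) = cong₂ (λ a b → ¬̇ (¬̇ a ∧̇ ¬̇ b)) (N-sub σ φ) (N-sub σ ψ)
N-sub σ (φ ⇒ ψ) = cong₂ _⇒_ (N-sub σ φ) (N-sub σ ψ)
N-sub σ (∀̇ φ)   = cong ∀̇ (N-sub (liftS σ) φ)
N-sub σ (∃̇ φ)   = cong (λ a → ¬̇ (∀̇ (¬̇ a))) (N-sub (liftS σ) φ)

N-ren : ∀ ρ φ → N (ren ρ φ) ≡ ren ρ (N φ)
N-ren ρ fal     = refl
N-ren ρ (t ≐ s) = refl
N-ren ρ (φ ∧̇ ψ) = cong₂ _∧̇_ (N-ren ρ φ) (N-ren ρ ψ)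
N-ren ρ (φ ∨̇ ψ) = cong₂ (λ a b → ¬̇ (¬̇ a ∧̇ ¬̇ b)) (N-ren ρ φ) (N-ren ρ ψ)
N-ren ρ (φ ⇒ ψ) = cong₂ _⇒_ (N-ren ρ φ) (N-ren ρ ψ)
N-ren ρ (∀̇ φ)   = cong ∀̇ (N-ren (liftR ρ) φ)
N-ren ρ (∃̇ φ)   = cong (λ a → ¬̇ (∀̇ (¬̇ a))) (N-ren (liftR ρ) φ)

map-N-shift : ∀ Γ → map N (map shift Γ) ≡ map shift (map N Γ)
map-N-shift []      = refl
map-N-shift (φ ∷ Γ) = cong₂ _∷_ (N-ren suc φ) (map-N-shift Γ)

N-stable : ∀ {A} φ → Prov A (¬̇ (¬̇ (N φ)) ⇒ N φ)
N-stable fal     = ⇒I (⇒E #0 (⇒I #0))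
N-stable (t ≐ s) = ¬¬¬⇒¬ _
N-stable (φ ∧̇ ψ) = ⇒I (∧I (mp (N-stable φ) (⇒I (⇒E #1 (⇒I (⇒E #1 (∧E₁ #0))))))
                         (mp (N-stable ψ) (⇒I (⇒E #1 (⇒I (⇒E #1 (∧E₂ #0)))))))
N-stable (φ ∨̇ ψ) = ¬¬¬⇒¬ _
N-stable (φ ⇒ ψ) = ⇒I (⇒I (mp (N-stable ψ) (⇒I (⇒E #2 (⇒I (⇒E #1 (⇒E #0 #2)))))))
N-stable (∀̇ φ)   = ⇒I (∀I (mp (N-stable φ) (⇒I (⇒E #1 (⇒I (⇒E #1 (∀E-var0 #0)))))))
N-stable (∃̇ φ)   = ¬¬¬⇒¬ _

module _ {X B : Theory} (X⊢N : ∀ χ → X χ → Prov B (N χ)) where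

  N-sound : ∀ {Γ φ} → (LEMall ⊕ X) ∣ Γ ⊢ φ → B ∣ map N Γ ⊢ N φ
  N-sound (ax (inj₁ (ψ , refl))) = ⇒I (⇒E (∧E₂ #0) (∧E₁ #0))
  N-sound (ax (inj₂ x))    = Prov⇒⊢ (X⊢N _ x)
  N-sound (hyp i)          = hyp (∈-map⁺ N i)
  N-sound (⊥E d)           = ⊥E (N-sound d)
  N-sound (∧I d e)         = ∧I (N-sound d) (N-sound e)
  N-sound (∧E₁ d)          = ∧E₁ (N-sound d)
  N-sound (∧E₂ d)          = ∧E₂ (N-sound d)
  N-sound (∨I₁ d)          = ⇒I (⇒E (∧E₁ #0) (weaken₁ (N-sound d)))
  N-sound (∨I₂ d)          = ⇒I (⇒E (∧E₂ #0) (weaken₁ (N-sound d)))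
  N-sound (∨E {χ = χ} d e f) =
    mp (N-stable χ) (⇒I (⇒E (weaken₁ (N-sound d))
      (∧I (⇒I (⇒E #1 (weaken (∷⁺ʳ _ there) (N-sound e))))
          (⇒I (⇒E #1 (weaken (∷⁺ʳ _ there) (N-sound f)))))))
  N-sound (⇒I d)           = ⇒I (N-sound d)
  N-sound (⇒E d e)         = ⇒E (N-sound d) (N-sound e)
  N-sound (∀I {Γ = Γ} d)   = ∀I (subst (λ Δ → B ∣ Δ ⊢ _) (map-N-shift Γ) (N-sound d))
  N-sound (∀E {φ = φ} t d) = cast (sym (N-sub (single t) φ)) (∀E t (N-sound d))
  N-sound (∃I {φ = φ} t d) = ⇒I (⇒E (∀E t #0) (weaken₁ (cast (N-sub (single t) φ) (N-sound d))))
  N-sound (∃E {Γ = Γ} {φ} {ψ} d e) =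
    mp (N-stable ψ) (⇒I (⇒E (weaken₁ (N-sound d)) (∀I (⇒I (⇒E #1 (weaken (∷⁺ʳ _ there) eᴺ))))))
    where
      eᴺ : B ∣ N φ ∷ map shift (map N Γ) ⊢ shift (N ψ)
      eᴺ = cast (N-ren suc ψ) (subst (λ Δ → B ∣ N φ ∷ Δ ⊢ _) (map-N-shift Γ) (N-sound e))
  N-sound (≐refl t)        = ¬¬-intro (≐refl t)
  N-sound (≐subst φ {t} {s} d e) =
    mp (N-stable (φ [ s ])) (⇒I (⇒E (weaken₁ (N-sound d)) (⇒I (⇒E #1
      (cast (sym (N-sub (single s) φ))
        (≐subst (N φ) #0 (weaken₁ (weaken₁ (cast (N-sub (single t) φ) (N-sound e))))))))))
  N-sound (succ≢0 t)       = ⇒I (⇒E #0 (succ≢0 t))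
  N-sound (succInj t s)    = ⇒I (⇒I (⇒E #1 (⇒I (⇒E #1 (⇒E (succInj t s) #0)))))
  N-sound (projAx i ts)    = ¬¬-intro (projAx i ts)
  N-sound (compAx f gs ts) = ¬¬-intro (compAx f gs ts)
  N-sound (rec0Ax g h ts)  = ¬¬-intro (rec0Ax g h ts)
  N-sound (recSAx g h t ts) = ¬¬-intro (recSAx g h t ts)
  N-sound (ind φ d e)      =
    ind (N φ) (cast (N-sub (single 0̇) φ) (N-sound d))
              (cast (cong (λ a → ∀̇ (N φ ⇒ a)) (N-sub succSub φ)) (N-sound e))

N⇒¬¬ ¬¬⇒N Stable Decided : Theory → Formula → Set
N⇒¬¬ A ψ    = Prov A (N ψ ⇒ ¬̇ (¬̇ ψ))
¬¬⇒N A ψ    = Prov A (¬̇ (¬̇ ψ) ⇒ N ψ)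
Stable A ψ  = Prov A (¬̇ (¬̇ ψ) ⇒ ψ)
Decided A ψ = Prov A (ψ ∨̇ ¬̇ ψ)

infix 3 _⊢_⟺_

_⊢_⟺_ : Theory → Formula → Formula → Set
A ⊢ a ⟺ b = Prov A (a ⇒ b) × Prov A (b ⇒ a)

module _ {A : Theory} where

  ¬¬-map : ∀ {a b} → Prov A (a ⇒ b) → Prov A (¬̇ (¬̇ a) ⇒ ¬̇ (¬̇ b))
  ¬¬-map a⇒b = ⇒I (⇒I (⇒E #1 (⇒I (⇒E #1 (mp a⇒b #0)))))

  N⇒¬¬-fal : N⇒¬¬ A fal
  N⇒¬¬-fal = ⇒I (¬¬-intro #0)

  N⇒¬¬-≐ : ∀ t s → N⇒¬¬ A (t ≐ s)
  N⇒¬¬-≐ t s = ⇒I #0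

  N⇒¬¬-∧ : ∀ {a b} → N⇒¬¬ A a → N⇒¬¬ A b → N⇒¬¬ A (a ∧̇ b)
  N⇒¬¬-∧ ha hb = ⇒I (⇒I (⇒E (mp ha (∧E₁ #1)) (⇒I (⇒E (mp hb (∧E₂ #2)) (⇒I (⇒E #2 (∧I #1 #0)))))))

  N⇒¬¬-∨ : ∀ {a b} → N⇒¬¬ A a → N⇒¬¬ A b → N⇒¬¬ A (a ∨̇ b)
  N⇒¬¬-∨ ha hb = ⇒I (⇒I (⇒E #1 (∧I (⇒I (⇒E (mp ha #0) (⇒I (⇒E #2 (∨I₁ #0)))))
                                    (⇒I (⇒E (mp hb #0) (⇒I (⇒E #2 (∨I₂ #0))))))))

  N⇒¬¬-⇒ : ∀ {a b} → ¬¬⇒N A a → N⇒¬¬ A b → N⇒¬¬ A (a ⇒ b)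
  N⇒¬¬-⇒ {a} {b} ha hb = ⇒I (⇒I (⇒E (mp hb (⇒E #1 (mp ha ¬¬a))) ¬b))
    where
      ¬¬a : A ∣ ¬̇ (a ⇒ b) ∷ (N a ⇒ N b) ∷ [] ⊢ ¬̇ (¬̇ a)
      ¬¬a = ⇒I (⇒E #1 (⇒I (⊥E (⇒E #1 #0))))
      ¬b : A ∣ ¬̇ (a ⇒ b) ∷ (N a ⇒ N b) ∷ [] ⊢ ¬̇ b
      ¬b = ⇒I (⇒E #1 (⇒I #1))

  N⇒¬¬-∀ : ∀ {a} → N⇒¬¬ A a → Stable A a → N⇒¬¬ A (∀̇ a)
  N⇒¬¬-∀ ha sa = ⇒I (¬¬-intro (∀I (mp sa (mp ha (∀E-var0 #0)))))

  N⇒¬¬-∃ : ∀ {a} → N⇒¬¬ A a → N⇒¬¬ A (∃̇ a)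
  N⇒¬¬-∃ ha = ⇒I (⇒I (⇒E #1 (∀I (⇒I (⇒E (mp ha #0) (⇒I (⇒E #2 (∃I-var0 #0))))))))

  ¬¬⇒N-fal : ¬¬⇒N A fal
  ¬¬⇒N-fal = ⇒I (⇒E #0 (⇒I #0))

  ¬¬⇒N-≐ : ∀ t s → ¬¬⇒N A (t ≐ s)
  ¬¬⇒N-≐ t s = ⇒I #0

  ¬¬⇒N-∧ : ∀ {a b} → ¬¬⇒N A a → ¬¬⇒N A b → ¬¬⇒N A (a ∧̇ b)
  ¬¬⇒N-∧ ha hb = ⇒I (∧I (mp ha (mp (¬¬-map (⇒I (∧E₁ #0))) #0)) (mp hb (mp (¬¬-map (⇒I (∧E₂ #0))) #0)))

  ¬¬⇒N-∨ : ∀ {a b} → ¬¬⇒N A a → ¬¬⇒N A b → ¬¬⇒N A (a ∨̇ b)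
  ¬¬⇒N-∨ ha hb = ⇒I (⇒I (⇒E #1 (⇒I (∨E #0 (⇒E (∧E₁ #2) (mp ha (¬¬-intro #0)))
                                          (⇒E (∧E₂ #2) (mp hb (¬¬-intro #0)))))))

  ¬¬⇒N-⇒ : ∀ {a b} → N⇒¬¬ A a → ¬¬⇒N A b → ¬¬⇒N A (a ⇒ b)
  ¬¬⇒N-⇒ ha hb = ⇒I (⇒I (mp hb (⇒I (⇒E (mp ha #1) (⇒I (⇒E #3 (⇒I (⇒E #2 (⇒E #0 #1)))))))))

  ¬¬⇒N-∀ : ∀ {a} → ¬¬⇒N A a → ¬¬⇒N A (∀̇ a)
  ¬¬⇒N-∀ ha = ⇒I (∀I (mp ha (⇒I (⇒E #1 (⇒I (⇒E #1 (∀E-var0 #0)))))))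

  ¬¬⇒N-∃ : ∀ {a} → ¬¬⇒N A a → ¬¬⇒N A (∃̇ a)
  ¬¬⇒N-∃ ha = ⇒I (⇒I (⇒E #1 (⇒I (∃E #0 (⇒E (∀E-var0 #2) (mp ha (¬¬-intro #0)))))))

  N⇒¬¬-QF : ∀ {ψ} → QF ψ → N⇒¬¬ A ψ
  ¬¬⇒N-QF : ∀ {ψ} → QF ψ → ¬¬⇒N A ψ
  N⇒¬¬-QF qfFal       = N⇒¬¬-fal
  N⇒¬¬-QF (qfEq t s)  = N⇒¬¬-≐ t s
  N⇒¬¬-QF (qf∧ a b)   = N⇒¬¬-∧ (N⇒¬¬-QF a) (N⇒¬¬-QF b)
  N⇒¬¬-QF (qf∨ a b)   = N⇒¬¬-∨ (N⇒¬¬-QF a) (N⇒¬¬-QF b)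
  N⇒¬¬-QF (qf⇒ a b)   = N⇒¬¬-⇒ (¬¬⇒N-QF a) (N⇒¬¬-QF b)
  ¬¬⇒N-QF qfFal       = ¬¬⇒N-fal
  ¬¬⇒N-QF (qfEq t s)  = ¬¬⇒N-≐ t s
  ¬¬⇒N-QF (qf∧ a b)   = ¬¬⇒N-∧ (¬¬⇒N-QF a) (¬¬⇒N-QF b)
  ¬¬⇒N-QF (qf∨ a b)   = ¬¬⇒N-∨ (¬¬⇒N-QF a) (¬¬⇒N-QF b)
  ¬¬⇒N-QF (qf⇒ a b)   = ¬¬⇒N-⇒ (N⇒¬¬-QF a) (¬¬⇒N-QF b)

  Decided⇒Stable : ∀ {a} → Decided A a → Stable A a
  Decided⇒Stable da = ⇒I (∨E (Prov⇒⊢ da) #0 (⊥E (⇒E #1 #0)))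

  Stable-∀ : ∀ {a} → Stable A a → Stable A (∀̇ a)
  Stable-∀ sa = ⇒I (∀I (mp sa (⇒I (⇒E #1 (⇒I (⇒E #1 (∀E-var0 #0)))))))

  Decided-fal : Decided A fal
  Decided-fal = ∨I₂ (⇒I #0)

  Decided-∧ : ∀ {a b} → Decided A a → Decided A b → Decided A (a ∧̇ b)
  Decided-∧ da db = ∨E (Prov⇒⊢ da) (∨E (Prov⇒⊢ db) (∨I₁ (∧I #1 #0)) (∨I₂ (⇒I (⇒E #1 (∧E₂ #0)))))
                                   (∨I₂ (⇒I (⇒E #1 (∧E₁ #0))))

  Decided-∨ : ∀ {a b} → Decided A a → Decided A b → Decided A (a ∨̇ b)
  Decided-∨ da db = ∨E (Prov⇒⊢ da) (∨I₁ (∨I₁ #0))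
                      (∨E (Prov⇒⊢ db) (∨I₁ (∨I₂ #0)) (∨I₂ (⇒I (∨E #0 (⇒E #3 #0) (⇒E #2 #0)))))

  Decided-⇒ : ∀ {a b} → Decided A a → Decided A b → Decided A (a ⇒ b)
  Decided-⇒ da db = ∨E (Prov⇒⊢ da) (∨E (Prov⇒⊢ db) (∨I₁ (⇒I #1)) (∨I₂ (⇒I (⇒E #1 (⇒E #0 #2)))))
                                   (∨I₁ (⇒I (⊥E (⇒E #1 #0))))

  Decided¬⇒Decided : ∀ {a} → Decided A (¬̇ a) → Stable A a → Decided A a
  Decided¬⇒Decided d¬a sa = ∨E (Prov⇒⊢ d¬a) (∨I₂ #0) (∨I₁ (mp sa #0))

  Decided-⟺ : ∀ {a b} → A ⊢ a ⟺ b → Decided A b → Decided A a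
  Decided-⟺ (a⇒b , b⇒a) db = ∨E (Prov⇒⊢ db) (∨I₁ (mp b⇒a #0)) (∨I₂ (⇒I (⇒E #1 (mp a⇒b #0))))

-- The shape of the alternation paths of Σⱼ (Πⱼ) formulas: a path opening with the class's
-- own quantifier may have length j, one opening with the other quantifier only j − 1.
ΣPath ΠPath : ℕ → Path → Set
ΣPath j []          = ⊤
ΣPath j (plus ∷ s)  = suc (length s) ≤ j
ΣPath j (minus ∷ s) = suc (length s) < j
ΠPath j []          = ⊤
ΠPath j (minus ∷ s) = suc (length s) ≤ j
ΠPath j (plus ∷ s)  = suc (length s) < j

AltΣ AltΠ Alt≤ : ℕ → Formula → Set
AltΣ j ψ = All (ΣPath j) (Alt ψ)
AltΠ j ψ = All (ΠPath j) (Alt ψ)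
Alt≤ j ψ = All (λ s → length s ≤ j) (Alt ψ)

module _ {P : Path → Set} where

  Alt-∧ˡ : ∀ a b → All P (Alt (a ∧̇ b)) → All P (Alt a)
  Alt-∧ˡ a b = ++⁻ˡ (Alt a)

  Alt-∧ʳ : ∀ a b → All P (Alt (a ∧̇ b)) → All P (Alt b)
  Alt-∧ʳ a b = ++⁻ʳ (Alt a)

  Alt-∨ˡ : ∀ a b → All P (Alt (a ∨̇ b)) → All P (Alt a)
  Alt-∨ˡ a b = ++⁻ˡ (Alt a)

  Alt-∨ʳ : ∀ a b → All P (Alt (a ∨̇ b)) → All P (Alt b)
  Alt-∨ʳ a b = ++⁻ʳ (Alt a)

  Alt-⇒ˡ : ∀ a b → All P (Alt (a ⇒ b)) → All (λ s → P (perp s)) (Alt a)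
  Alt-⇒ˡ a b x = map⁻ (++⁻ˡ (map perp (Alt a)) x)

  Alt-⇒ʳ : ∀ a b → All P (Alt (a ⇒ b)) → All P (Alt b)
  Alt-⇒ʳ a b = ++⁻ʳ (map perp (Alt a))

Alt-nonempty : ∀ ψ {P : Path → Set} → All P (Alt ψ) → Σ Path P
Alt-nonempty fal     (p ∷ _) = _ , p
Alt-nonempty (t ≐ s) (p ∷ _) = _ , p
Alt-nonempty (a ∧̇ b) x       = Alt-nonempty a (Alt-∧ˡ a b x)
Alt-nonempty (a ∨̇ b) x       = Alt-nonempty a (Alt-∨ˡ a b x)
Alt-nonempty (a ⇒ b) x       = let s , p = Alt-nonempty a (Alt-⇒ˡ a b x) in perp s , p
Alt-nonempty (∀̇ a)   x       = let s , p = Alt-nonempty a (map⁻ x) in stepAll s , p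
Alt-nonempty (∃̇ a)   x       = let s , p = Alt-nonempty a (map⁻ x) in stepEx s , p

QF⇒Alt : ∀ {ψ} {P : Path → Set} → QF ψ → P [] → All P (Alt ψ)
QF⇒Alt qfFal      p = p ∷ []
QF⇒Alt (qfEq t s) p = p ∷ []
QF⇒Alt (qf∧ a b)  p = ++⁺ (QF⇒Alt a p) (QF⇒Alt b p)
QF⇒Alt (qf∨ a b)  p = ++⁺ (QF⇒Alt a p) (QF⇒Alt b p)
QF⇒Alt (qf⇒ a b)  p = ++⁺ (map⁺ (QF⇒Alt a p)) (QF⇒Alt b p)

ΣPath-perp : ∀ j s → ΣPath j (perp s) → ΠPath j s
ΣPath-perp j []          p = p
ΣPath-perp j (plus ∷ s)  p = subst (λ n → suc n < j) (length-map flipS s) p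
ΣPath-perp j (minus ∷ s) p = subst (λ n → suc n ≤ j) (length-map flipS s) p

ΠPath-perp : ∀ j s → ΠPath j (perp s) → ΣPath j s
ΠPath-perp j []          p = p
ΠPath-perp j (plus ∷ s)  p = subst (λ n → suc n ≤ j) (length-map flipS s) p
ΠPath-perp j (minus ∷ s) p = subst (λ n → suc n < j) (length-map flipS s) p

AltΣ-⇒ˡ : ∀ j a b → AltΣ j (a ⇒ b) → AltΠ j a
AltΣ-⇒ˡ j a b x = All-map (λ {s} → ΣPath-perp j s) (Alt-⇒ˡ a b x)

AltΠ-⇒ˡ : ∀ j a b → AltΠ j (a ⇒ b) → AltΣ j a
AltΠ-⇒ˡ j a b x = All-map (λ {s} → ΠPath-perp j s) (Alt-⇒ˡ a b x)

Alt≤-⇒ˡ : ∀ j a b → Alt≤ j (a ⇒ b) → Alt≤ j a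
Alt≤-⇒ˡ j a b x = All-map (λ {s} p → subst (_≤ j) (length-map flipS s) p) (Alt-⇒ˡ a b x)

Alt≤-∀ : ∀ j a → Alt≤ j (∀̇ a) → Alt≤ j a
Alt≤-∀ j a x = All-map (λ {s} → ≤-trans (grows s)) (map⁻ x)
  where
    grows : ∀ s → length s ≤ length (stepAll s)
    grows []          = z≤n
    grows (plus ∷ s)  = n≤1+n _
    grows (minus ∷ s) = ≤-refl

Alt≤-∃ : ∀ j a → Alt≤ j (∃̇ a) → Alt≤ j a
Alt≤-∃ j a x = All-map (λ {s} → ≤-trans (grows s)) (map⁻ x)
  where
    grows : ∀ s → length s ≤ length (stepEx s)
    grows []          = z≤n
    grows (plus ∷ s)  = ≤-refl
    grows (minus ∷ s) = n≤1+n _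

Alt≤-∀⇒AltΠ : ∀ j a → Alt≤ j (∀̇ a) → AltΠ j (∀̇ a)
Alt≤-∀⇒AltΠ j a x = map⁺ (All-map (λ {s} → fits s) (map⁻ x))
  where
    fits : ∀ s → length (stepAll s) ≤ j → ΠPath j (stepAll s)
    fits []          p = p
    fits (plus ∷ s)  p = p
    fits (minus ∷ s) p = p

Alt≤-∃⇒AltΣ : ∀ j a → Alt≤ j (∃̇ a) → AltΣ j (∃̇ a)
Alt≤-∃⇒AltΣ j a x = map⁺ (All-map (λ {s} → fits s) (map⁻ x))
  where
    fits : ∀ s → length (stepEx s) ≤ j → ΣPath j (stepEx s)
    fits []          p = p
    fits (plus ∷ s)  p = p
    fits (minus ∷ s) p = p

deg≤⇒Alt≤ : ∀ {m} ψ → Fplus m ψ → Alt≤ m ψ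
deg≤⇒Alt≤ {m} ψ = go (Alt ψ)
  where
    go : ∀ ss → foldr (λ s n → length s ⊔ n) 0 ss ≤ m → All (λ s → length s ≤ m) ss
    go []       _ = []
    go (s ∷ ss) d = m⊔n≤o⇒m≤o (length s) _ d ∷ go ss (m⊔n≤o⇒n≤o (length s) _ d)

AltΣ⇒Alt≤ : ∀ {j} ψ → AltΣ j ψ → Alt≤ j ψ
AltΣ⇒Alt≤ _ = All-map (λ {s} → bound s)
  where
    bound : ∀ {j} s → ΣPath j s → length s ≤ j
    bound []          _ = z≤n
    bound (plus ∷ s)  p = p
    bound (minus ∷ s) p = <⇒≤ p

Sig⇒AltΣ : ∀ {j ψ} → Sig j ψ → AltΣ j ψ
Pi⇒AltΠ  : ∀ {j ψ} → Pi j ψ → AltΠ j ψ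
Sig⇒AltΣ (sig0 q) = QF⇒Alt q tt
Sig⇒AltΣ (sigB p) = All-map (λ {s} → fits s) (Pi⇒AltΠ p)
  where
    fits : ∀ {k} s → ΠPath k s → ΣPath (suc k) s
    fits []          _ = tt
    fits (plus ∷ s)  p = m≤n⇒m≤1+n (<⇒≤ p)
    fits (minus ∷ s) p = s≤s p
Sig⇒AltΣ (sig∃ p) = map⁺ (All-map (λ {s} → fits s) (Sig⇒AltΣ p))
  where
    fits : ∀ {k} s → ΣPath (suc k) s → ΣPath (suc k) (stepEx s)
    fits []          _ = s≤s z≤n
    fits (plus ∷ s)  p = p
    fits (minus ∷ s) p = p
Pi⇒AltΠ (pi0 q) = QF⇒Alt q tt
Pi⇒AltΠ (piB p) = All-map (λ {s} → fits s) (Sig⇒AltΣ p)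
  where
    fits : ∀ {k} s → ΣPath k s → ΠPath (suc k) s
    fits []          _ = tt
    fits (minus ∷ s) p = m≤n⇒m≤1+n (<⇒≤ p)
    fits (plus ∷ s)  p = s≤s p
Pi⇒AltΠ (pi∀ p) = map⁺ (All-map (λ {s} → fits s) (Pi⇒AltΠ p))
  where
    fits : ∀ {k} s → ΠPath (suc k) s → ΠPath (suc k) (stepAll s)
    fits []          _ = s≤s z≤n
    fits (plus ∷ s)  p = p
    fits (minus ∷ s) p = p

AltΣ-∃ : ∀ {j} a → AltΣ j (∃̇ a) → Σ ℕ λ i → j ≡ suc i × AltΣ (suc i) a
AltΣ-∃ {zero} a x with Alt-nonempty a (map⁻ x)
... | []        , ()
... | plus ∷ _  , ()
... | minus ∷ _ , ()
AltΣ-∃ {suc i} a x = i , refl , All-map (λ {s} → fits s) (map⁻ x)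
  where
    fits : ∀ s → ΣPath (suc i) (stepEx s) → ΣPath (suc i) s
    fits []          _ = tt
    fits (plus ∷ s)  p = p
    fits (minus ∷ s) p = p

AltΠ-∀ : ∀ {j} a → AltΠ j (∀̇ a) → Σ ℕ λ i → j ≡ suc i × AltΠ (suc i) a
AltΠ-∀ {zero} a x with Alt-nonempty a (map⁻ x)
... | []        , ()
... | plus ∷ _  , ()
... | minus ∷ _ , ()
AltΠ-∀ {suc i} a x = i , refl , All-map (λ {s} → fits s) (map⁻ x)
  where
    fits : ∀ s → ΠPath (suc i) (stepAll s) → ΠPath (suc i) s
    fits []          _ = tt
    fits (plus ∷ s)  p = p
    fits (minus ∷ s) p = p

AltΣ-∀ : ∀ {j} a → AltΣ j (∀̇ a) → Σ ℕ λ i → j ≡ suc (suc i) × AltΠ (suc i) a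
AltΣ-∀ {zero} a x with Alt-nonempty a (map⁻ x)
... | []        , ()
... | plus ∷ _  , ()
... | minus ∷ _ , ()
AltΣ-∀ {suc zero} a x with Alt-nonempty a (map⁻ x)
... | []        , s≤s ()
... | plus ∷ _  , s≤s ()
... | minus ∷ _ , s≤s ()
AltΣ-∀ {suc (suc i)} a x = i , refl , All-map (λ {s} → fits s) (map⁻ x)
  where
    fits : ∀ s → ΣPath (suc (suc i)) (stepAll s) → ΠPath (suc i) s
    fits []          _       = tt
    fits (plus ∷ s)  (s≤s p) = p
    fits (minus ∷ s) (s≤s p) = p

AltΠ-∃ : ∀ {j} a → AltΠ j (∃̇ a) → Σ ℕ λ i → j ≡ suc (suc i) × AltΣ (suc i) a
AltΠ-∃ {zero} a x with Alt-nonempty a (map⁻ x)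
... | []        , ()
... | plus ∷ _  , ()
... | minus ∷ _ , ()
AltΠ-∃ {suc zero} a x with Alt-nonempty a (map⁻ x)
... | []        , s≤s ()
... | plus ∷ _  , s≤s ()
... | minus ∷ _ , s≤s ()
AltΠ-∃ {suc (suc i)} a x = i , refl , All-map (λ {s} → fits s) (map⁻ x)
  where
    fits : ∀ s → ΠPath (suc (suc i)) (stepEx s) → ΣPath (suc i) s
    fits []          _       = tt
    fits (plus ∷ s)  (s≤s p) = p
    fits (minus ∷ s) (s≤s p) = p

QF-ren : ∀ ρ {φ} → QF φ → QF (ren ρ φ)
QF-ren ρ qfFal      = qfFal
QF-ren ρ (qfEq t s) = qfEq _ _
QF-ren ρ (qf∧ a b)  = qf∧ (QF-ren ρ a) (QF-ren ρ b)
QF-ren ρ (qf∨ a b)  = qf∨ (QF-ren ρ a) (QF-ren ρ b)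
QF-ren ρ (qf⇒ a b)  = qf⇒ (QF-ren ρ a) (QF-ren ρ b)

Sig-ren : ∀ ρ {j φ} → Sig j φ → Sig j (ren ρ φ)
Pi-ren  : ∀ ρ {j φ} → Pi j φ → Pi j (ren ρ φ)
Sig-ren ρ (sig0 q) = sig0 (QF-ren ρ q)
Sig-ren ρ (sigB p) = sigB (Pi-ren ρ p)
Sig-ren ρ (sig∃ s) = sig∃ (Sig-ren (liftR ρ) s)
Pi-ren ρ (pi0 q)   = pi0 (QF-ren ρ q)
Pi-ren ρ (piB s)   = piB (Sig-ren ρ s)
Pi-ren ρ (pi∀ p)   = pi∀ (Pi-ren (liftR ρ) p)

Sig-suc : ∀ {j φ} → Sig j φ → Sig (suc j) φ
Pi-suc  : ∀ {j φ} → Pi j φ → Pi (suc j) φ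
Sig-suc (sig0 q) = sigB (pi0 q)
Sig-suc (sigB p) = sigB (Pi-suc p)
Sig-suc (sig∃ s) = sig∃ (Sig-suc s)
Pi-suc (pi0 q)   = piB (sig0 q)
Pi-suc (piB s)   = piB (Sig-suc s)
Pi-suc (pi∀ p)   = pi∀ (Pi-suc p)

Sig-mono : ∀ {j m φ} → j ≤ m → Sig j φ → Sig m φ
Sig-mono j≤m = go (≤⇒≤′ j≤m)
  where
    go : ∀ {j m φ} → j ≤′ m → Sig j φ → Sig m φ
    go ≤′-refl      s = s
    go (≤′-step j≤m) s = Sig-suc (go j≤m s)

QF⇒Sig : ∀ j {φ} → QF φ → Sig j φ
QF⇒Pi  : ∀ j {φ} → QF φ → Pi j φ
QF⇒Sig zero    q = sig0 q
QF⇒Sig (suc j) q = sigB (QF⇒Pi j q)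
QF⇒Pi zero     q = pi0 q
QF⇒Pi (suc j)  q = piB (QF⇒Sig j q)

-- Prenex normal forms

module _ {A : Theory} where

  ⟺-refl : ∀ {a} → A ⊢ a ⟺ a
  ⟺-refl = ⇒I #0 , ⇒I #0

  ⟺-trans : ∀ {a b c} → A ⊢ a ⟺ b → A ⊢ b ⟺ c → A ⊢ a ⟺ c
  ⟺-trans (f , g) (f′ , g′) = ⇒I (mp f′ (mp f #0)) , ⇒I (mp g (mp g′ #0))

  ⟺-∧ : ∀ {a a′ b b′} → A ⊢ a ⟺ a′ → A ⊢ b ⟺ b′ → A ⊢ a ∧̇ b ⟺ a′ ∧̇ b′
  ⟺-∧ (f , g) (f′ , g′) = ⇒I (∧I (mp f (∧E₁ #0)) (mp f′ (∧E₂ #0)))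
                        , ⇒I (∧I (mp g (∧E₁ #0)) (mp g′ (∧E₂ #0)))

  ⟺-∨ : ∀ {a a′ b b′} → A ⊢ a ⟺ a′ → A ⊢ b ⟺ b′ → A ⊢ a ∨̇ b ⟺ a′ ∨̇ b′
  ⟺-∨ (f , g) (f′ , g′) = ⇒I (∨E #0 (∨I₁ (mp f #0)) (∨I₂ (mp f′ #0)))
                        , ⇒I (∨E #0 (∨I₁ (mp g #0)) (∨I₂ (mp g′ #0)))

  ⟺-⇒ : ∀ {a a′ b b′} → A ⊢ a ⟺ a′ → A ⊢ b ⟺ b′ → A ⊢ a ⇒ b ⟺ a′ ⇒ b′
  ⟺-⇒ (f , g) (f′ , g′) = ⇒I (⇒I (mp f′ (⇒E #1 (mp g #0))))
                        , ⇒I (⇒I (mp g′ (⇒E #1 (mp f #0))))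

  ⟺-∀ : ∀ {a a′} → A ⊢ a ⟺ a′ → A ⊢ ∀̇ a ⟺ ∀̇ a′
  ⟺-∀ (f , g) = ⇒I (∀I (mp f (∀E-var0 #0))) , ⇒I (∀I (mp g (∀E-var0 #0)))

  ⟺-∃ : ∀ {a a′} → A ⊢ a ⟺ a′ → A ⊢ ∃̇ a ⟺ ∃̇ a′
  ⟺-∃ (f , g) = ⇒I (∃E #0 (∃I-var0 (mp f #0))) , ⇒I (∃E #0 (∃I-var0 (mp g #0)))

  ∃∧-pull : ∀ a b → A ⊢ (∃̇ a) ∧̇ b ⟺ ∃̇ (a ∧̇ shift b)
  ∃∧-pull a b = ⇒I (∃E (∧E₁ #0) (∃I-var0 (∧I #0 (∧E₂ #1))))
              , ⇒I (∃E #0 (∧I (∃I-var0 (∧E₁ #0)) (∧E₂ #0)))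

  ∧∃-pull : ∀ a b → A ⊢ a ∧̇ ∃̇ b ⟺ ∃̇ (shift a ∧̇ b)
  ∧∃-pull a b = ⇒I (∃E (∧E₂ #0) (∃I-var0 (∧I (∧E₁ #1) #0)))
              , ⇒I (∃E #0 (∧I (∧E₁ #0) (∃I-var0 (∧E₂ #0))))

  ∀∧-pull : ∀ a b → A ⊢ (∀̇ a) ∧̇ b ⟺ ∀̇ (a ∧̇ shift b)
  ∀∧-pull a b = ⇒I (∀I (∧I (∀E-var0 (∧E₁ #0)) (∧E₂ #0)))
              , ⇒I (∧I (∀I (∧E₁ (∀E-var0 #0))) (cast ([]-shift b 0̇) (∧E₂ (∀E 0̇ #0))))

  ∧∀-pull : ∀ a b → A ⊢ a ∧̇ ∀̇ b ⟺ ∀̇ (shift a ∧̇ b)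
  ∧∀-pull a b = ⇒I (∀I (∧I (∧E₁ #0) (∀E-var0 (∧E₂ #0))))
              , ⇒I (∧I (cast ([]-shift a 0̇) (∧E₁ (∀E 0̇ #0))) (∀I (∧E₂ (∀E-var0 #0))))

  ∃∨-pull : ∀ a b → A ⊢ (∃̇ a) ∨̇ b ⟺ ∃̇ (a ∨̇ shift b)
  ∃∨-pull a b = ⇒I (∨E #0 (∃E #0 (∃I-var0 (∨I₁ #0))) (∃I 0̇ (∨I₂ (cast (sym ([]-shift b 0̇)) #0))))
              , ⇒I (∃E #0 (∨E #0 (∨I₁ (∃I-var0 #0)) (∨I₂ #0)))

  ∨∃-pull : ∀ a b → A ⊢ a ∨̇ ∃̇ b ⟺ ∃̇ (shift a ∨̇ b)
  ∨∃-pull a b = ⇒I (∨E #0 (∃I 0̇ (∨I₁ (cast (sym ([]-shift a 0̇)) #0))) (∃E #0 (∃I-var0 (∨I₂ #0))))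
              , ⇒I (∃E #0 (∨E #0 (∨I₁ #0) (∨I₂ (∃I-var0 #0))))

  ∀∨-pull : ∀ a b → Decided A b → A ⊢ (∀̇ a) ∨̇ b ⟺ ∀̇ (a ∨̇ shift b)
  ∀∨-pull a b db = ⇒I (∀I (∨E #0 (∨I₁ (∀E-var0 #0)) (∨I₂ #0)))
                 , ⇒I (∨E (Prov⇒⊢ db) (∨I₂ #0)
                        (∨I₁ (∀I (∨E (∀E-var0 #1) #0 (⊥E (⇒E #1 #0))))))

  ∨∀-pull : ∀ a b → Decided A a → A ⊢ a ∨̇ ∀̇ b ⟺ ∀̇ (shift a ∨̇ b)
  ∨∀-pull a b da = ⇒I (∀I (∨E #0 (∨I₁ #0) (∨I₂ (∀E-var0 #0))))
                 , ⇒I (∨E (Prov⇒⊢ da) (∨I₁ #0)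
                        (∨I₂ (∀I (∨E (∀E-var0 #1) (⊥E (⇒E #1 #0)) #0))))

  ¬∃⟺∀¬ : ∀ a → A ⊢ ¬̇ (∃̇ a) ⟺ ∀̇ (¬̇ a)
  ¬∃⟺∀¬ a = ⇒I (∀I (⇒I (⇒E #1 (∃I-var0 #0))))
          , ⇒I (⇒I (∃E #0 (⇒E (∀E-var0 #2) #0)))

  ¬∀⟺∃¬ : ∀ a → Decided A (∃̇ (¬̇ a)) → Stable A a → A ⊢ ¬̇ (∀̇ a) ⟺ ∃̇ (¬̇ a)
  ¬∀⟺∃¬ a d sa = ⇒I (∨E (Prov⇒⊢ d) #0 (⊥E (⇒E #1 (∀I (mp sa (⇒I (⇒E #1 (∃I-var0 #0))))))))
               , ⇒I (⇒I (∃E #1 (⇒E #0 (∀E-var0 #1))))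

  ⇒⟺¬∨ : ∀ a b → Decided A a → A ⊢ a ⇒ b ⟺ ¬̇ a ∨̇ b
  ⇒⟺¬∨ a b da = ⇒I (∨E (Prov⇒⊢ da) (∨I₂ (⇒E #1 #0)) (∨I₁ #0))
              , ⇒I (⇒I (∨E #1 (⊥E (⇒E #0 #1)) #0))

HasΣForm HasΠForm : Theory → ℕ → Formula → Set
HasΣForm A j ψ = Σ Formula λ σ → Sig j σ × A ⊢ ψ ⟺ σ
HasΠForm A j ψ = Σ Formula λ π → Pi j π × A ⊢ ψ ⟺ π

module _ {A : Theory} where

  ΣForm-⟺ : ∀ {j ψ ψ′} → A ⊢ ψ ⟺ ψ′ → HasΣForm A j ψ′ → HasΣForm A j ψ
  ΣForm-⟺ e (σ , s , e′) = σ , s , ⟺-trans e e′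

  ΠForm-⟺ : ∀ {j ψ ψ′} → A ⊢ ψ ⟺ ψ′ → HasΠForm A j ψ′ → HasΠForm A j ψ
  ΠForm-⟺ e (π , p , e′) = π , p , ⟺-trans e e′

  ΣForm-∃ : ∀ {k ψ a} → A ⊢ ψ ⟺ ∃̇ a → HasΣForm A (suc k) a → HasΣForm A (suc k) ψ
  ΣForm-∃ e (σ , s , e′) = ∃̇ σ , sig∃ s , ⟺-trans e (⟺-∃ e′)

  ΠForm-∀ : ∀ {k ψ a} → A ⊢ ψ ⟺ ∀̇ a → HasΠForm A (suc k) a → HasΠForm A (suc k) ψ
  ΠForm-∀ e (π , p , e′) = ∀̇ π , pi∀ p , ⟺-trans e (⟺-∀ e′)

  ΠForm⇒ΣForm : ∀ {k ψ} → HasΠForm A k ψ → HasΣForm A (suc k) ψ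
  ΠForm⇒ΣForm (π , p , e) = π , sigB p , e

  ΣForm⇒ΠForm : ∀ {k ψ} → HasΣForm A k ψ → HasΠForm A (suc k) ψ
  ΣForm⇒ΠForm (σ , s , e) = σ , piB s , e

  Σ∧Σ : ∀ {j a b} → Sig j a → Sig j b → HasΣForm A j (a ∧̇ b)
  Π∧Σ : ∀ {k a b} → Pi k a → Sig (suc k) b → HasΣForm A (suc k) (a ∧̇ b)
  Π∧Π : ∀ {j a b} → Pi j a → Pi j b → HasΠForm A j (a ∧̇ b)
  Σ∧Π : ∀ {k a b} → Sig k a → Pi (suc k) b → HasΠForm A (suc k) (a ∧̇ b)
  Σ∧Σ (sig0 q) (sig0 q′)    = _ , sig0 (qf∧ q q′) , ⟺-refl
  Σ∧Σ {a = ∃̇ a} {b} (sig∃ s) sb = ΣForm-∃ (∃∧-pull a b) (Σ∧Σ s (Sig-ren suc sb))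
  Σ∧Σ (sigB p) sb           = Π∧Σ p sb
  Π∧Σ p (sigB q)            = ΠForm⇒ΣForm (Π∧Π p q)
  Π∧Σ {a = a} {∃̇ b} p (sig∃ s) = ΣForm-∃ (∧∃-pull a b) (Π∧Σ (Pi-ren suc p) s)
  Π∧Π (pi0 q) (pi0 q′)      = _ , pi0 (qf∧ q q′) , ⟺-refl
  Π∧Π {a = ∀̇ a} {b} (pi∀ p) pb = ΠForm-∀ (∀∧-pull a b) (Π∧Π p (Pi-ren suc pb))
  Π∧Π (piB s) pb            = Σ∧Π s pb
  Σ∧Π s (piB s′)            = ΣForm⇒ΠForm (Σ∧Σ s s′)
  Σ∧Π {a = a} {∀̇ b} s (pi∀ p) = ΠForm-∀ (∧∀-pull a b) (Σ∧Π (Sig-ren suc s) p)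

module UnderLEM {A : Theory} {m : ℕ} (lem : ∀ φ → Sig m φ → Decided A φ) where

  Sig-decided : ∀ {j a} → j ≤ m → Sig j a → Decided A a
  Sig-decided j≤m s = lem _ (Sig-mono j≤m s)

  Pi-stable : ∀ {j a} → j ≤ suc m → Pi j a → Stable A a
  Pi-stable _         (pi0 q) = Decided⇒Stable (lem _ (QF⇒Sig m q))
  Pi-stable (s≤s j≤m) (piB s) = Decided⇒Stable (Sig-decided j≤m s)
  Pi-stable j≤1+m     (pi∀ p) = Stable-∀ (Pi-stable j≤1+m p)

  ¬Σ : ∀ {j a} → j ≤ m → Sig j a → HasΠForm A j (¬̇ a)
  ¬Π : ∀ {j a} → j ≤ m → Pi j a → HasΣForm A j (¬̇ a)
  ¬Σ _   (sig0 q) = _ , pi0 (qf⇒ q qfFal) , ⟺-refl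
  ¬Σ j≤m (sigB p) = ΣForm⇒ΠForm (¬Π (<⇒≤ j≤m) p)
  ¬Σ {a = ∃̇ a} j≤m (sig∃ s) = ΠForm-∀ (¬∃⟺∀¬ a) (¬Σ j≤m s)
  ¬Π _   (pi0 q) = _ , sig0 (qf⇒ q qfFal) , ⟺-refl
  ¬Π j≤m (piB s) = ΠForm⇒ΣForm (¬Σ (<⇒≤ j≤m) s)
  ¬Π {a = ∀̇ a} j≤m (pi∀ p) =
    let σ , s , e = ¬Π j≤m p
        ∃¬a-decided = Decided-⟺ (⟺-∃ e) (Sig-decided j≤m (sig∃ s))
    in ΣForm-∃ (¬∀⟺∃¬ a ∃¬a-decided (Pi-stable (m≤n⇒m≤1+n j≤m) p)) (σ , s , e)

  Pi-decided : ∀ {j a} → j ≤ m → Pi j a → Decided A a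
  Pi-decided j≤m p =
    let σ , s , e = ¬Π j≤m p
    in Decided¬⇒Decided (Decided-⟺ e (Sig-decided j≤m s)) (Pi-stable (m≤n⇒m≤1+n j≤m) p)

  Σ∨Σ : ∀ {j a b} → j ≤ m → Sig j a → Sig j b → HasΣForm A j (a ∨̇ b)
  Π∨Σ : ∀ {k a b} → suc k ≤ m → Pi k a → Sig (suc k) b → HasΣForm A (suc k) (a ∨̇ b)
  Π∨Π : ∀ {j a b} → j ≤ m → Pi j a → Pi j b → HasΠForm A j (a ∨̇ b)
  Σ∨Π : ∀ {k a b} → suc k ≤ m → Sig k a → Pi (suc k) b → HasΠForm A (suc k) (a ∨̇ b)
  Σ∨Σ _ (sig0 q) (sig0 q′)   = _ , sig0 (qf∨ q q′) , ⟺-refl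
  Σ∨Σ {a = ∃̇ a} {b} j≤m (sig∃ s) sb = ΣForm-∃ (∃∨-pull a b) (Σ∨Σ j≤m s (Sig-ren suc sb))
  Σ∨Σ j≤m (sigB p) sb        = Π∨Σ j≤m p sb
  Π∨Σ k<m p (sigB q)         = ΠForm⇒ΣForm (Π∨Π (<⇒≤ k<m) p q)
  Π∨Σ {a = a} {∃̇ b} k<m p (sig∃ s) = ΣForm-∃ (∨∃-pull a b) (Π∨Σ k<m (Pi-ren suc p) s)
  Π∨Π _ (pi0 q) (pi0 q′)     = _ , pi0 (qf∨ q q′) , ⟺-refl
  Π∨Π {a = ∀̇ a} {b} j≤m (pi∀ p) pb =
    ΠForm-∀ (∀∨-pull a b (Pi-decided j≤m pb)) (Π∨Π j≤m p (Pi-ren suc pb))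
  Π∨Π j≤m (piB s) pb         = Σ∨Π j≤m s pb
  Σ∨Π k<m s (piB s′)         = ΣForm⇒ΠForm (Σ∨Σ (<⇒≤ k<m) s s′)
  Σ∨Π {a = a} {∀̇ b} k<m s (pi∀ p) =
    ΠForm-∀ (∨∀-pull a b (Sig-decided (<⇒≤ k<m) s)) (Σ∨Π k<m (Sig-ren suc s) p)

  Π⇒Σ : ∀ {j a b} → j ≤ m → Pi j a → Sig j b → HasΣForm A j (a ⇒ b)
  Π⇒Σ {a = a} {b} j≤m pa sb =
    let σ , s , e = ¬Π j≤m pa
    in ΣForm-⟺ (⟺-trans (⇒⟺¬∨ a b (Pi-decided j≤m pa)) (⟺-∨ e ⟺-refl)) (Σ∨Σ j≤m s sb)

  Σ⇒Π : ∀ {j a b} → j ≤ m → Sig j a → Pi j b → HasΠForm A j (a ⇒ b)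
  Σ⇒Π {a = a} {b} j≤m sa pb =
    let π , p , e = ¬Σ j≤m sa
    in ΠForm-⟺ (⟺-trans (⇒⟺¬∨ a b (Sig-decided j≤m sa)) (⟺-∨ e ⟺-refl)) (Π∨Π j≤m p pb)

  prenexΣ : ∀ {j} ψ → j ≤ m → AltΣ j ψ → HasΣForm A j ψ
  prenexΠ : ∀ {j} ψ → j ≤ m → AltΠ j ψ → HasΠForm A j ψ
  prenexΣ {j} fal     _ _ = fal , QF⇒Sig j qfFal , ⟺-refl
  prenexΣ {j} (t ≐ s) _ _ = t ≐ s , QF⇒Sig j (qfEq t s) , ⟺-refl
  prenexΣ (a ∧̇ b) j≤m x =
    let _ , sa , ea = prenexΣ a j≤m (Alt-∧ˡ a b x)
        _ , sb , eb = prenexΣ b j≤m (Alt-∧ʳ a b x)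
    in ΣForm-⟺ (⟺-∧ ea eb) (Σ∧Σ sa sb)
  prenexΣ (a ∨̇ b) j≤m x =
    let _ , sa , ea = prenexΣ a j≤m (Alt-∨ˡ a b x)
        _ , sb , eb = prenexΣ b j≤m (Alt-∨ʳ a b x)
    in ΣForm-⟺ (⟺-∨ ea eb) (Σ∨Σ j≤m sa sb)
  prenexΣ {j} (a ⇒ b) j≤m x =
    let _ , pa , ea = prenexΠ a j≤m (AltΣ-⇒ˡ j a b x)
        _ , sb , eb = prenexΣ b j≤m (Alt-⇒ʳ a b x)
    in ΣForm-⟺ (⟺-⇒ ea eb) (Π⇒Σ j≤m pa sb)
  prenexΣ (∀̇ a) j≤m x with AltΣ-∀ a x
  ... | _ , refl , y = ΠForm⇒ΣForm (ΠForm-∀ ⟺-refl (prenexΠ a (<⇒≤ j≤m) y))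
  prenexΣ (∃̇ a) j≤m x with AltΣ-∃ a x
  ... | _ , refl , y = ΣForm-∃ ⟺-refl (prenexΣ a j≤m y)
  prenexΠ {j} fal     _ _ = fal , QF⇒Pi j qfFal , ⟺-refl
  prenexΠ {j} (t ≐ s) _ _ = t ≐ s , QF⇒Pi j (qfEq t s) , ⟺-refl
  prenexΠ (a ∧̇ b) j≤m x =
    let _ , pa , ea = prenexΠ a j≤m (Alt-∧ˡ a b x)
        _ , pb , eb = prenexΠ b j≤m (Alt-∧ʳ a b x)
    in ΠForm-⟺ (⟺-∧ ea eb) (Π∧Π pa pb)
  prenexΠ (a ∨̇ b) j≤m x =
    let _ , pa , ea = prenexΠ a j≤m (Alt-∨ˡ a b x)
        _ , pb , eb = prenexΠ b j≤m (Alt-∨ʳ a b x)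
    in ΠForm-⟺ (⟺-∨ ea eb) (Π∨Π j≤m pa pb)
  prenexΠ {j} (a ⇒ b) j≤m x =
    let _ , sa , ea = prenexΣ a j≤m (AltΠ-⇒ˡ j a b x)
        _ , pb , eb = prenexΠ b j≤m (Alt-⇒ʳ a b x)
    in ΠForm-⟺ (⟺-⇒ ea eb) (Σ⇒Π j≤m sa pb)
  prenexΠ (∀̇ a) j≤m x with AltΠ-∀ a x
  ... | _ , refl , y = ΠForm-∀ ⟺-refl (prenexΠ a j≤m y)
  prenexΠ (∃̇ a) j≤m x with AltΠ-∃ a x
  ... | _ , refl , y = ΣForm⇒ΠForm (ΣForm-∃ ⟺-refl (prenexΣ a (<⇒≤ j≤m) y))

  Alt≤-decided : ∀ ψ → Alt≤ m ψ → Decided A ψ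
  Alt≤-decided fal     _ = Decided-fal
  Alt≤-decided (t ≐ s) _ = lem _ (QF⇒Sig m (qfEq t s))
  Alt≤-decided (a ∧̇ b) x = Decided-∧ (Alt≤-decided a (Alt-∧ˡ a b x)) (Alt≤-decided b (Alt-∧ʳ a b x))
  Alt≤-decided (a ∨̇ b) x = Decided-∨ (Alt≤-decided a (Alt-∨ˡ a b x)) (Alt≤-decided b (Alt-∨ʳ a b x))
  Alt≤-decided (a ⇒ b) x = Decided-⇒ (Alt≤-decided a (Alt≤-⇒ˡ m a b x)) (Alt≤-decided b (Alt-⇒ʳ a b x))
  Alt≤-decided (∀̇ a)   x =
    let _ , p , e = prenexΠ (∀̇ a) ≤-refl (Alt≤-∀⇒AltΠ m a x) in Decided-⟺ e (Pi-decided ≤-refl p)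
  Alt≤-decided (∃̇ a)   x =
    let _ , s , e = prenexΣ (∃̇ a) ≤-refl (Alt≤-∃⇒AltΣ m a x) in Decided-⟺ e (Sig-decided ≤-refl s)

  Alt≤-N⟺¬¬ : ∀ ψ → Alt≤ m ψ → A ⊢ N ψ ⟺ ¬̇ (¬̇ ψ)
  Alt≤-N⟺¬¬ fal     _ = N⇒¬¬-fal , ¬¬⇒N-fal
  Alt≤-N⟺¬¬ (t ≐ s) _ = N⇒¬¬-≐ t s , ¬¬⇒N-≐ t s
  Alt≤-N⟺¬¬ (a ∧̇ b) x =
    let ha , ha′ = Alt≤-N⟺¬¬ a (Alt-∧ˡ a b x)
        hb , hb′ = Alt≤-N⟺¬¬ b (Alt-∧ʳ a b x)
    in N⇒¬¬-∧ ha hb , ¬¬⇒N-∧ ha′ hb′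
  Alt≤-N⟺¬¬ (a ∨̇ b) x =
    let ha , ha′ = Alt≤-N⟺¬¬ a (Alt-∨ˡ a b x)
        hb , hb′ = Alt≤-N⟺¬¬ b (Alt-∨ʳ a b x)
    in N⇒¬¬-∨ ha hb , ¬¬⇒N-∨ ha′ hb′
  Alt≤-N⟺¬¬ (a ⇒ b) x =
    let ha , ha′ = Alt≤-N⟺¬¬ a (Alt≤-⇒ˡ m a b x)
        hb , hb′ = Alt≤-N⟺¬¬ b (Alt-⇒ʳ a b x)
    in N⇒¬¬-⇒ ha′ hb , ¬¬⇒N-⇒ ha hb′
  Alt≤-N⟺¬¬ (∀̇ a)   x =
    let ha , ha′ = Alt≤-N⟺¬¬ a (Alt≤-∀ m a x)
    in N⇒¬¬-∀ ha (Decided⇒Stable (Alt≤-decided a (Alt≤-∀ m a x))) , ¬¬⇒N-∀ ha′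
  Alt≤-N⟺¬¬ (∃̇ a)   x =
    let ha , ha′ = Alt≤-N⟺¬¬ a (Alt≤-∃ m a x)
    in N⇒¬¬-∃ ha , ¬¬⇒N-∃ ha′

  R-¬¬⇒N : ∀ {ψ} → R (suc m) ψ → ¬¬⇒N A ψ
  J-N⇒¬¬ : ∀ {ψ} → J (suc m) ψ → N⇒¬¬ A ψ
  R-¬¬⇒N {ψ} (rF d) = proj₂ (Alt≤-N⟺¬¬ ψ (deg≤⇒Alt≤ ψ d))
  R-¬¬⇒N (r∧ a b)  = ¬¬⇒N-∧ (R-¬¬⇒N a) (R-¬¬⇒N b)
  R-¬¬⇒N (r∨ a b)  = ¬¬⇒N-∨ (R-¬¬⇒N a) (R-¬¬⇒N b)
  R-¬¬⇒N (r∀ a)    = ¬¬⇒N-∀ (R-¬¬⇒N a)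
  R-¬¬⇒N (r⇒ j r)  = ¬¬⇒N-⇒ (J-N⇒¬¬ j) (R-¬¬⇒N r)
  J-N⇒¬¬ {ψ} (jF d) = proj₁ (Alt≤-N⟺¬¬ ψ (deg≤⇒Alt≤ ψ d))
  J-N⇒¬¬ (j∧ a b)  = N⇒¬¬-∧ (J-N⇒¬¬ a) (J-N⇒¬¬ b)
  J-N⇒¬¬ (j∨ a b)  = N⇒¬¬-∨ (J-N⇒¬¬ a) (J-N⇒¬¬ b)
  J-N⇒¬¬ (j∃ a)    = N⇒¬¬-∃ (J-N⇒¬¬ a)
  J-N⇒¬¬ (j⇒ r j)  = N⇒¬¬-⇒ (R-¬¬⇒N r) (J-N⇒¬¬ j)

  Q-¬¬⇒N : ∀ {ψ} → Q (suc m) ψ → ¬¬⇒N A ψ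
  Q-¬¬⇒N (qEq t s) = ¬¬⇒N-≐ t s
  Q-¬¬⇒N qFal      = ¬¬⇒N-fal
  Q-¬¬⇒N (q∧ a b)  = ¬¬⇒N-∧ (Q-¬¬⇒N a) (Q-¬¬⇒N b)
  Q-¬¬⇒N (q∨ a b)  = ¬¬⇒N-∨ (Q-¬¬⇒N a) (Q-¬¬⇒N b)
  Q-¬¬⇒N (q∀ a)    = ¬¬⇒N-∀ (Q-¬¬⇒N a)
  Q-¬¬⇒N (q∃ a)    = ¬¬⇒N-∃ (Q-¬¬⇒N a)
  Q-¬¬⇒N (q⇒ j q)  = ¬¬⇒N-⇒ (J-N⇒¬¬ j) (Q-¬¬⇒N q)

  Pi-N⇒¬¬ : ∀ {ψ} → Pi (suc m) ψ → N⇒¬¬ A ψ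
  Pi-N⇒¬¬ {ψ} (piB s) = proj₁ (Alt≤-N⟺¬¬ ψ (AltΣ⇒Alt≤ ψ (Sig⇒AltΣ s)))
  Pi-N⇒¬¬ (pi∀ p) = N⇒¬¬-∀ (Pi-N⇒¬¬ p) (Pi-stable ≤-refl p)

Q-¬¬⇒N : ∀ k {A ψ} → LEMbelow k A → Q k ψ → ¬¬⇒N A ψ
Q-¬¬⇒N zero    _   (q0 q) = ¬¬⇒N-QF q
Q-¬¬⇒N (suc m) lem q      = UnderLEM.Q-¬¬⇒N lem q

Pi-N⇒¬¬ : ∀ k {A ψ} → LEMbelow k A → Pi k ψ → N⇒¬¬ A ψ
Pi-N⇒¬¬ zero    _   (pi0 q) = N⇒¬¬-QF q
Pi-N⇒¬¬ (suc m) lem p       = UnderLEM.Pi-N⇒¬¬ lem p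

Sig-N⇒¬¬ : ∀ k {A ψ} → LEMbelow k A → Sig (suc k) ψ → N⇒¬¬ A ψ
Sig-N⇒¬¬ k lem (sigB p) = Pi-N⇒¬¬ k lem p
Sig-N⇒¬¬ k lem (sig∃ s) = N⇒¬¬-∃ (Sig-N⇒¬¬ k lem s)

proposition6p3 : (k : ℕ) (T : Theory) → SemiClassical T → LEMbelow k T
                 → (X : Theory) → (∀ φ → X φ → Sentence φ × Q k φ)
                 → ConservativeΣ k T X ⇔ DNERClosedΣ k T X
proposition6p3 k T T⊆PA lem X X⊆Q = mk⇔ conservative⇒DNER DNER⇒conservative
  where
    T⊕X⊆PA⊕X : ∀ ψ → (T ⊕ X) ψ → Prov (LEMall ⊕ X) ψ
    T⊕X⊆PA⊕X ψ (inj₁ t) = ⊕-inj₁ (T⊆PA ψ t)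
    T⊕X⊆PA⊕X ψ (inj₂ x) = ax (inj₂ x)

    conservative⇒DNER : ConservativeΣ k T X → DNERClosedΣ k T X
    conservative⇒DNER conservative φ closed σ ⊢¬¬φ =
      conservative φ closed σ (mp (Decided⇒Stable (ax (inj₁ (φ , refl)))) (reaxiomatise T⊕X⊆PA⊕X ⊢¬¬φ))

    X⊢N : ∀ χ → X χ → Prov (T ⊕ X) (N χ)
    X⊢N χ x = mp (⊕-inj₁ (Q-¬¬⇒N k lem (proj₂ (X⊆Q χ x)))) (¬¬-intro (ax (inj₂ x)))

    DNER⇒conservative : DNERClosedΣ k T X → ConservativeΣ k T X
    DNER⇒conservative DNER φ closed σ ⊢φ =
      DNER φ closed σ (mp (⊕-inj₁ (Sig-N⇒¬¬ k lem σ)) (N-sound X⊢N ⊢φ))
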